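{- For every integer $k\ge 3$ there exists a positive integer $m=m(k)$ such that the following holds for every $n\ge m$. Let $H$ be the full-$k$-star with vertex set $\{0\}\cup[n]$ and center $0$. Then there exist $k$-uniform hypergraphs $F$ and $G$ such that: the vertex set $V(F)$ of $F$ is a subset of $[n]$ of size at most $m$; $G$ is a subhypergraph of $H$; and $H':=(H\setminus G)\cup F$ is tight-cycle-free and has exactly $e(H)+1$ edges.
   Context: $[n]=\{1,\dots,n\}$, and $e(\cdot)$ denotes the number of edges. The full-$k$-star on vertex set $V$ with center $x\in V$ is the $k$-uniform hypergraph whose edges are all $k$-subsets of $V$ containing $x$. For hypergraphs on a common vertex set, $\setminus$ and $\cup$ refer to edge sets. For $\ell\ge k+1$, the tight cycle $TC_\ell^k$ is the $k$-uniform hypergraph on $\ell$ distinct vertices $v_0,\dots,v_{\ell-1}$ with edges $\{v_i,\dots,v_{i+k-1}\}$ (subscripts mod $\ell$); a $k$-uniform hypergraph is tight-cycle-free if it contains no subhypergraph isomorphic to $TC_\ell^k$ for any $\ell\ge k+1$. -}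

module Defs where

open import Data.Nat using (ℕ; zero; suc; _≡ᵇ_)
open import Data.Nat.DivMod using (_mod_)
open import Data.Bool using (Bool; true; false; _∧_; not; _∨_; T)
open import Data.Fin using (Fin; toℕ)
import Data.Fin as Fin
open import Data.Fin.Subset using (Subset; _∈_; _∉_; _⊆_; ∣_∣)
open import Data.Vec using (Vec; []; _∷_)
open import Data.List using (List; []; _∷_; _++_; map; filter; length)
open import Data.Product using (Σ; ∃; _×_)
open import Relation.Binary.PropositionalEquality using (_≡_)
open import Relation.Nullary using (¬_)
open import Function.Definitions using (Injective)

Hypergraph : ℕ → Set
Hypergraph N = Subset N → Bool

IsEdge : ∀ {N} → Hypergraph N → Subset N → Set
IsEdge H e = T (H e)

Uniform : ∀ {N} → ℕ → Hypergraph N → Set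
Uniform k H = ∀ e → IsEdge H e → ∣ e ∣ ≡ k

allSubsets : ∀ N → List (Subset N)
allSubsets zero = [] ∷ []
allSubsets (suc N) = map (true ∷_) (allSubsets N) ++ map (false ∷_) (allSubsets N)

edges : ∀ {N} → Hypergraph N → ℕ
edges {N} H = length (filter (λ e → T? (H e)) (allSubsets N))
  where
  open import Relation.Nullary using (Dec; yes; no)
  T? : (b : Bool) → Dec (T b)
  T? true = yes _
  T? false = no (λ ())

-- full-k-star on {0} ∪ [n] = Fin (suc n) with center 0 (= Fin.zero):
-- edges are all k-subsets containing 0.
fullStar : ∀ k n → Hypergraph (suc n)
fullStar k n (b ∷ e) = b ∧ (∣ b ∷ e ∣ ≡ᵇ k)

_∖_ : ∀ {N} → Hypergraph N → Hypergraph N → Hypergraph N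
(H ∖ G) e = H e ∧ not (G e)

_∪_ : ∀ {N} → Hypergraph N → Hypergraph N → Hypergraph N
(H ∪ G) e = H e ∨ G e

_⊑_ : ∀ {N} → Hypergraph N → Hypergraph N → Set
G ⊑ H = ∀ e → IsEdge G e → IsEdge H e

-- A copy of the tight cycle TC^k_ℓ with ℓ = suc p vertices v_0..v_p
-- (injective map v), edges {v_i, ..., v_{i+k-1}} (indices mod ℓ).
TightCycleCopy : ∀ {N} → ℕ → (p : ℕ) → Hypergraph N → Set
TightCycleCopy {N} k p H =
  Σ (Fin (suc p) → Fin N) λ v → Injective _≡_ _≡_ v ×
    (∀ (i : Fin (suc p)) → ∃ λ e → IsEdge H e ×
       (∀ x → x ∈ e → ∃ λ (j : Fin k) → v ((toℕ i ℕ+ toℕ j) mod suc p) ≡ x) ×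
       (∀ (j : Fin k) → v ((toℕ i ℕ+ toℕ j) mod suc p) ∈ e))
  where open Data.Nat using () renaming (_+_ to _ℕ+_)

TightCycleFree : ∀ {N} → ℕ → Hypergraph N → Set
TightCycleFree k H = ∀ p → suc k Data.Nat.≤ suc p → ¬ TightCycleCopy k p H
  where import Data.Nat

-- Lemma 3.4: for k ≥ 3 and n ≥ 2k, deleting k - 1 edges G from the full
-- k-star H on {0, ..., n} (centre 0) and adding k edges F on {1, ..., 2k-1}
-- gives a tight-cycle-free H′ = (H ∖ G) ∪ F with e(H′) = e(H) + 1; m = 2k.
--
-- Windows avoiding the centre are edges of
-- F, and only A, B ∈ F can be consecutive windows, so no three consecutive
-- windows avoid the centre; this excludes cycles missing the centre and of
-- length ≥ k + 3.  For lengths k + 1, k + 2 a window through the centre lies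
-- in an edge of G, hence equals it, but H′ has no edge of G.
module Submission where

open import Defs
open import Data.Nat using (ℕ; zero; suc; _≤_; _<_; _+_; s≤s; z≤n; s≤s⁻¹)
open import Data.Nat.Properties using (≤-trans; 1+n≰n; m≤m+n)
open import Data.Fin using (Fin)
open import Data.Fin.Subset using (Subset; _∈_; _∉_; _⊆_; ∣_∣)
open import Data.Fin.Subset.Properties using (drop-∷-⊆; p⊆q⇒∣p∣≤∣q∣)
open import Data.Bool using (Bool; true; false)
open import Data.Vec using ([]; _∷_; here)
open import Data.Product using (Σ; ∃; _×_; _,_)
open import Data.Empty using (⊥-elim)
open import Relation.Binary.PropositionalEquality using (_≡_; _≢_; refl; cong)

bit : Bool → ℕ
bit true = 1
bit false = 0

⊆-card-eq : ∀ {N} (X Y : Subset N) → X ⊆ Y → ∣ Y ∣ ≤ ∣ X ∣ → X ≡ Y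
⊆-card-eq [] [] _ _ = refl
⊆-card-eq (true ∷ X) (true ∷ Y) X⊆Y ∣Y∣≤∣X∣ = cong (true ∷_) (⊆-card-eq X Y (drop-∷-⊆ X⊆Y) (s≤s⁻¹ ∣Y∣≤∣X∣))
⊆-card-eq (true ∷ X) (false ∷ Y) X⊆Y _ with X⊆Y here
... | ()
⊆-card-eq (false ∷ X) (true ∷ Y) X⊆Y ∣Y∣≤∣X∣ = ⊥-elim (1+n≰n (≤-trans ∣Y∣≤∣X∣ (p⊆q⇒∣p∣≤∣q∣ (drop-∷-⊆ X⊆Y))))
⊆-card-eq (false ∷ X) (false ∷ Y) X⊆Y ∣Y∣≤∣X∣ = cong (false ∷_) (⊆-card-eq X Y (drop-∷-⊆ X⊆Y) ∣Y∣≤∣X∣)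

-- At most one vertex of X lies outside Y; consecutive windows of a tight
-- cycle have this property.
AtMostOneOutside : ∀ {N} → Subset N → Subset N → Set
AtMostOneOutside X Y = ∀ {x y} → x ∈ X → x ∉ Y → y ∈ X → y ∉ Y → x ≡ y

-- Counting edges.  'edges' filters the list of all subsets; we replace it by a
-- structural count that splits on the first vertex, for which additivity and
-- the count of a hypergraph given by a list of distinct edges are easy.
module Counting where

  open import Data.Nat.Properties using (+-identityʳ; +-commutativeSemigroup)
  open import Algebra.Properties.CommutativeSemigroup +-commutativeSemigroup using (interchange)
  open import Data.Bool using (_∧_; _∨_; not; T)
  open import Data.Bool.Properties using () renaming (_≟_ to _≟ᵇ_)
  open import Data.Vec using ([]; _∷_)
  open import Data.Vec.Properties using (≡-dec)
  open import Data.List using (List; []; _∷_; _++_; map; filter; length)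
  open import Data.List.Properties using (filter-++; length-++)
  open import Data.List.Membership.Propositional using () renaming (_∈_ to _∈ₗ_)
  open import Data.List.Relation.Unary.Any using (any?)
  open import Data.List.Relation.Unary.All using (lookup)
  open import Data.List.Relation.Unary.AllPairs using (AllPairs; []; _∷_)
  open import Relation.Nullary using (¬_; does; Dec; yes; no)
  open import Relation.Unary using (Pred; Decidable)
  open import Relation.Binary.PropositionalEquality using (refl; sym; trans; cong; cong₂)
  open import Data.Empty using (⊥-elim)

  count : ∀ {N} → Hypergraph N → ℕ
  count {zero} H = bit (H [])
  count {suc N} H = count (λ e → H (true ∷ e)) + count (λ e → H (false ∷ e))

  private
    length-filter-map : ∀ {A B : Set} {p} {P : Pred B p} (P? : Decidable P) (f : A → B) xs →
      length (filter P? (map f xs)) ≡ length (filter (λ x → P? (f x)) xs)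
    length-filter-map P? f [] = refl
    length-filter-map P? f (x ∷ xs) with does (P? (f x))
    ... | true = cong suc (length-filter-map P? f xs)
    ... | false = length-filter-map P? f xs

  edges≡count : ∀ {N} (H : Hypergraph N) → edges H ≡ count H
  edges≡count {zero} H with H []
  ... | true = refl
  ... | false = refl
  edges≡count {suc N} H = begin
    length (filter _ (map (true ∷_) S ++ map (false ∷_) S))
      ≡⟨ cong length (filter-++ _ (map (true ∷_) S) _) ⟩
    length (filter _ (map (true ∷_) S) ++ filter _ (map (false ∷_) S))
      ≡⟨ length-++ (filter _ (map (true ∷_) S)) ⟩
    length (filter _ (map (true ∷_) S)) + length (filter _ (map (false ∷_) S))
      ≡⟨ cong₂ _+_ (trans (length-filter-map _ (true ∷_) S) (edges≡count (λ e → H (true ∷ e))))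
                   (trans (length-filter-map _ (false ∷_) S) (edges≡count (λ e → H (false ∷ e)))) ⟩
    count H ∎
    where
    open Relation.Binary.PropositionalEquality.≡-Reasoning
    S = allSubsets N

  count-additive : ∀ {N} (P Q R S : Hypergraph N) →
    (∀ e → bit (P e) + bit (Q e) ≡ bit (R e) + bit (S e)) →
    count P + count Q ≡ count R + count S
  count-additive {zero} P Q R S pw = pw []
  count-additive {suc N} P Q R S pw = begin
    (count (P ∘t) + count (P ∘f)) + (count (Q ∘t) + count (Q ∘f))
      ≡⟨ interchange (count (P ∘t)) _ _ _ ⟩
    (count (P ∘t) + count (Q ∘t)) + (count (P ∘f) + count (Q ∘f))
      ≡⟨ cong₂ _+_ (count-additive (P ∘t) (Q ∘t) (R ∘t) (S ∘t) (λ e → pw (true ∷ e)))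
                   (count-additive (P ∘f) (Q ∘f) (R ∘f) (S ∘f) (λ e → pw (false ∷ e))) ⟩
    (count (R ∘t) + count (S ∘t)) + (count (R ∘f) + count (S ∘f))
      ≡⟨ interchange (count (R ∘t)) _ _ _ ⟩
    (count (R ∘t) + count (R ∘f)) + (count (S ∘t) + count (S ∘f)) ∎
    where
    open Relation.Binary.PropositionalEquality.≡-Reasoning
    _∘t _∘f : Hypergraph (suc N) → Hypergraph N
    (H ∘t) e = H (true ∷ e)
    (H ∘f) e = H (false ∷ e)

  count-swap : ∀ {N} (H G F : Hypergraph N) → G ⊑ H → (∀ e → IsEdge F e → ¬ IsEdge H e) →
    count ((H ∖ G) ∪ F) + count G ≡ count H + count F
  count-swap H G F G⊑H F∩H=∅ = count-additive ((H ∖ G) ∪ F) G H F (λ e → swap (G⊑H e) (F∩H=∅ e))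
    where
    swap : ∀ {h g f} → (T g → T h) → (T f → ¬ T h) → bit ((h ∧ not g) ∨ f) + bit g ≡ bit h + bit f
    swap {true} {true} {true} _ f∉h = ⊥-elim (f∉h _ _)
    swap {true} {true} {false} _ _ = refl
    swap {true} {false} {true} _ f∉h = ⊥-elim (f∉h _ _)
    swap {true} {false} {false} _ _ = refl
    swap {false} {true} g⊆h _ = ⊥-elim (g⊆h _)
    swap {false} {false} {true} _ _ = refl
    swap {false} {false} {false} _ _ = refl

  count-empty : ∀ N → count {N} (λ _ → false) ≡ 0
  count-empty zero = refl
  count-empty (suc N) = cong₂ _+_ (count-empty N) (count-empty N)

  _≟ₛ_ : ∀ {N} (x y : Subset N) → Dec (x ≡ y)
  _≟ₛ_ = ≡-dec _≟ᵇ_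

  listed : ∀ {N} → List (Subset N) → Hypergraph N
  listed es e = does (any? (e ≟ₛ_) es)

  listed⁻ : ∀ {N} (es : List (Subset N)) {e} → T (listed es e) → e ∈ₗ es
  listed⁻ es {e} with any? (e ≟ₛ_) es
  ... | yes e∈es = λ _ → e∈es

  listed⁺ : ∀ {N} (es : List (Subset N)) {e} → e ∈ₗ es → T (listed es e)
  listed⁺ es {e} e∈es with any? (e ≟ₛ_) es
  ... | yes _ = _
  ... | no e∉es = e∉es e∈es

  count-single : ∀ {N} (x : Subset N) → count (λ e → does (e ≟ₛ x)) ≡ 1
  count-single [] = refl
  count-single {suc N} (true ∷ x) = cong₂ _+_ (count-single x) (count-empty N)
  count-single {suc N} (false ∷ x) = cong₂ _+_ (count-empty N) (count-single x)

  count-listed : ∀ {N} (es : List (Subset N)) → AllPairs _≢_ es → count (listed es) ≡ length es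
  count-listed {N} [] _ = count-empty N
  count-listed {N} (x ∷ es) (x∉es ∷ distinct) = begin
    count (listed (x ∷ es))                           ≡⟨ sym (+-identityʳ _) ⟩
    count (listed (x ∷ es)) + 0                       ≡⟨ cong (count (listed (x ∷ es)) +_) (sym (count-empty N)) ⟩
    count (listed (x ∷ es)) + count {N} (λ _ → false) ≡⟨ count-additive (listed (x ∷ es)) (λ _ → false) (λ e → does (e ≟ₛ x)) (listed es) split ⟩
    count (λ e → does (e ≟ₛ x)) + count (listed es)   ≡⟨ cong₂ _+_ (count-single x) (count-listed es distinct) ⟩
    suc (length es) ∎
    where
    open Relation.Binary.PropositionalEquality.≡-Reasoning
    split : ∀ e → bit (listed (x ∷ es) e) + 0 ≡ bit (does (e ≟ₛ x)) + bit (listed es e)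
    split e with e ≟ₛ x | any? (e ≟ₛ_) es
    ... | yes refl | yes x∈es = ⊥-elim (lookup x∉es x∈es refl)
    ... | yes _ | no _ = refl
    ... | no _ | yes _ = refl
    ... | no _ | no _ = refl

module NumberSets where

  open import Data.Nat using (_<_; z≤n; s≤s; _≡ᵇ_; _<ᵇ_)
  open import Data.Nat.Properties using (≡ᵇ⇒≡; ≡⇒≡ᵇ; <ᵇ⇒<; <⇒<ᵇ; +-suc)
  open import Data.Bool using (Bool; true; false; _∧_; _∨_; not; T)
  open import Data.Bool.Properties using (∧-identityʳ; ∨-identityʳ; T-≡)
  open import Function using (Equivalence)
  open import Data.Vec using ([]; _∷_; lookup)
  open import Data.Vec.Properties using ([]=⇒lookup; lookup⇒[]=)
  open import Data.Fin using (Fin; toℕ) renaming (zero to fzero; suc to fsuc)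
  open import Data.Fin.Subset using (Subset; _∈_; ∣_∣)
  open import Data.Product using (_×_; _,_)
  open import Data.Sum using (_⊎_; inj₁; inj₂)
  open import Relation.Binary.PropositionalEquality
  open import Relation.Nullary using (¬_)
  open import Data.Empty using (⊥-elim)

  select : ∀ {N} → (ℕ → Bool) → Subset N
  select {zero} g = []
  select {suc N} g = g 0 ∷ select (λ t → g (suc t))

  private
    lookup-select : ∀ {N} g (x : Fin N) → lookup (select g) x ≡ g (toℕ x)
    lookup-select g fzero = refl
    lookup-select g (fsuc x) = lookup-select (λ t → g (suc t)) x

  select⁻ : ∀ {N} g {x : Fin N} → x ∈ select g → T (g (toℕ x))
  select⁻ g {x} x∈ = Equivalence.from T-≡ (trans (sym (lookup-select g x)) ([]=⇒lookup x∈))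

  select⁺ : ∀ {N} g {x : Fin N} → T (g (toℕ x)) → x ∈ select g
  select⁺ g {x} gx = lookup⇒[]= x (select g) (trans (lookup-select g x) (Equivalence.to T-≡ gx))

  countBelow : ℕ → (ℕ → Bool) → ℕ
  countBelow zero g = 0
  countBelow (suc N) g = bit (g 0) + countBelow N (λ t → g (suc t))

  ∣select∣ : ∀ N g → ∣ select {N} g ∣ ≡ countBelow N g
  ∣select∣ zero g = refl
  ∣select∣ (suc N) g with g 0
  ... | true = cong suc (∣select∣ N _)
  ... | false = ∣select∣ N _

  countBelow-cong : ∀ N {g h} → (∀ t → g t ≡ h t) → countBelow N g ≡ countBelow N h
  countBelow-cong zero g≗h = refl
  countBelow-cong (suc N) g≗h = cong₂ _+_ (cong bit (g≗h 0)) (countBelow-cong N (λ t → g≗h (suc t)))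

  below : ℕ → ℕ → Bool
  below a t = t <ᵇ a

  delete : ℕ → (ℕ → Bool) → ℕ → Bool
  delete x g t = g t ∧ not (t ≡ᵇ x)

  insert : ℕ → (ℕ → Bool) → ℕ → Bool
  insert x g t = g t ∨ (t ≡ᵇ x)

  countBelow-below : ∀ N a → a ≤ N → countBelow N (below a) ≡ a
  countBelow-below zero zero _ = refl
  countBelow-below (suc N) zero _ = countBelow-below N zero z≤n
  countBelow-below (suc N) (suc a) (s≤s a≤N) = cong suc (countBelow-below N a a≤N)

  countBelow-delete : ∀ N x g → T (g x) → x < N → suc (countBelow N (delete x g)) ≡ countBelow N g
  countBelow-delete (suc N) zero g gx _ with g 0
  ... | true = cong suc (countBelow-cong N (λ t → ∧-identityʳ (g (suc t))))
  countBelow-delete (suc N) (suc x) g gx (s≤s x<N) = begin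
    suc (bit (g 0 ∧ true) + countBelow N (delete x g′)) ≡⟨ cong (λ b → suc (bit b + countBelow N (delete x g′))) (∧-identityʳ (g 0)) ⟩
    suc (bit (g 0) + countBelow N (delete x g′))        ≡⟨ sym (+-suc (bit (g 0)) _) ⟩
    bit (g 0) + suc (countBelow N (delete x g′))        ≡⟨ cong (bit (g 0) +_) (countBelow-delete N x g′ gx x<N) ⟩
    bit (g 0) + countBelow N g′ ∎
    where
    open ≡-Reasoning
    g′ = λ t → g (suc t)

  countBelow-insert : ∀ N x g → ¬ T (g x) → x < N → countBelow N (insert x g) ≡ suc (countBelow N g)
  countBelow-insert (suc N) zero g x∉g _ with g 0
  ... | true = ⊥-elim (x∉g _)
  ... | false = cong suc (countBelow-cong N (λ t → ∨-identityʳ (g (suc t))))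
  countBelow-insert (suc N) (suc x) g x∉g (s≤s x<N) = begin
    bit (g 0 ∨ false) + countBelow N (insert x g′) ≡⟨ cong₂ _+_ (cong bit (∨-identityʳ (g 0))) (countBelow-insert N x g′ x∉g x<N) ⟩
    bit (g 0) + suc (countBelow N g′)              ≡⟨ +-suc (bit (g 0)) _ ⟩
    suc (bit (g 0) + countBelow N g′) ∎
    where
    open ≡-Reasoning
    g′ = λ t → g (suc t)

  below⁻ : ∀ {a t} → T (below a t) → t < a
  below⁻ {a} {t} = <ᵇ⇒< t a

  below⁺ : ∀ {a t} → t < a → T (below a t)
  below⁺ = <⇒<ᵇ

  delete⁻ : ∀ x g {t} → T (delete x g t) → T (g t) × t ≢ x
  delete⁻ x g {t} h with g t | t ≡ᵇ x in t≡ᵇx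
  ... | true | false = _ , λ t≡x → subst T t≡ᵇx (≡⇒≡ᵇ t x t≡x)

  delete⁺ : ∀ x g {t} → T (g t) → t ≢ x → T (delete x g t)
  delete⁺ x g {t} gt t≢x with g t | t ≡ᵇ x in t≡ᵇx
  ... | true | false = _
  ... | true | true = t≢x (≡ᵇ⇒≡ t x (subst T (sym t≡ᵇx) _))

  insert⁻ : ∀ x g {t} → T (insert x g t) → T (g t) ⊎ t ≡ x
  insert⁻ x g {t} h with g t | t ≡ᵇ x in t≡ᵇx
  ... | true | _ = inj₁ _
  ... | false | true = inj₂ (≡ᵇ⇒≡ t x (subst T (sym t≡ᵇx) _))

  insert⁺ : ∀ x g {t} → T (g t) → T (insert x g t)
  insert⁺ x g {t} gt with g t
  ... | true = _

  insert-self : ∀ x g → T (insert x g x)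
  insert-self x g with g x
  ... | true = _
  ... | false = ≡⇒≡ᵇ x x refl

module Modular where

  open import Data.Nat using (_<_; _∸_; NonZero)
  open import Data.Nat.Properties
  open import Data.Nat.DivMod
  open import Relation.Binary.PropositionalEquality
  open import Relation.Nullary using (yes; no)

  %-shift : ∀ x j ℓ .{{_ : NonZero ℓ}} → (x % ℓ + j) % ℓ ≡ (x + j) % ℓ
  %-shift x j ℓ = begin
    (x % ℓ + j) % ℓ           ≡⟨ %-distribˡ-+ (x % ℓ) j ℓ ⟩
    (x % ℓ % ℓ + j % ℓ) % ℓ   ≡⟨ cong (λ z → (z + j % ℓ) % ℓ) (m%n%n≡m%n x ℓ) ⟩
    (x % ℓ + j % ℓ) % ℓ       ≡⟨ sym (%-distribˡ-+ x j ℓ) ⟩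
    (x + j) % ℓ ∎
    where open ≡-Reasoning

  %-shift-injective : ∀ x d ℓ .{{_ : NonZero ℓ}} → 0 < d → d < ℓ → x % ℓ ≢ (x + d) % ℓ
  %-shift-injective x d ℓ 0<d d<ℓ eq = residue (x % ℓ) (m%n<n x ℓ) (trans eq (sym (%-shift x d ℓ)))
    where
    residue : ∀ r → r < ℓ → r ≢ (r + d) % ℓ
    residue r r<ℓ eq with r + d <? ℓ
    ... | yes r+d<ℓ = <⇒≢ (m<m+n r 0<d) (trans eq (m<n⇒m%n≡m r+d<ℓ))
    ... | no r+d≮ℓ = <⇒≢ d<ℓ (sym (+-cancelˡ-≡ r ℓ d (trans (cong (_+ ℓ) r≡s) s+ℓ≡r+d)))
      where
      s = r + d ∸ ℓ
      s+ℓ≡r+d : s + ℓ ≡ r + d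
      s+ℓ≡r+d = m∸n+n≡m (≮⇒≥ r+d≮ℓ)
      s<ℓ : s < ℓ
      s<ℓ = +-cancelʳ-< ℓ s ℓ (subst (_< ℓ + ℓ) (sym s+ℓ≡r+d) (+-mono-< r<ℓ d<ℓ))
      r≡s : r ≡ s
      r≡s = trans eq (trans (cong (_% ℓ) (sym s+ℓ≡r+d)) (trans ([m+n]%n≡m%n s ℓ) (m<n⇒m%n≡m s<ℓ)))

-- Given a copy of TC^k_ℓ (ℓ = suc p > k) in H
-- and a starting position b, u s is the s-th cycle vertex after b (indices
-- taken mod ℓ) and W a is the edge {u a, ..., u (a+k-1)}.
module Windows {N} (k : ℕ) (H : Hypergraph N) (p : ℕ) (k<ℓ : k < suc p)
                   (C : TightCycleCopy k p H) (b : Fin (suc p)) where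

  open import Data.Nat using (_<_; _∸_; s≤s; z≤n; s≤s⁻¹)
  open import Data.Nat.Properties
  open import Data.Nat.DivMod
  open import Data.Fin using (Fin; toℕ; fromℕ<)
  open import Data.Fin.Properties using (toℕ-injective; toℕ-fromℕ<; toℕ<n)
  open import Data.Fin.Subset using (Subset; _∈_; _∉_)
  open import Data.Product using (Σ; _×_; _,_; proj₁; proj₂)
  open import Data.Sum using (_⊎_; inj₁; inj₂)
  open import Relation.Binary.PropositionalEquality
  open import Relation.Binary using (tri<; tri≈; tri>)
  open import Relation.Nullary using (yes; no)
  open import Data.Empty using (⊥; ⊥-elim)
  import Data.Sum
  open import Function.Definitions using (Injective)
  open Modular

  ℓ : ℕ
  ℓ = suc p

  v : Fin ℓ → Fin N
  v = proj₁ C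

  private
    v-injective : Injective _≡_ _≡_ v
    v-injective = proj₁ (proj₂ C)

    position : ℕ → Fin ℓ
    position s = (toℕ b + s) mod ℓ

    toℕ-position : ∀ s → toℕ (position s) ≡ (toℕ b + s) % ℓ
    toℕ-position s = toℕ-fromℕ< (m%n<n (toℕ b + s) ℓ)

    position-shift : ∀ a j → (toℕ (position a) + j) mod ℓ ≡ position (a + j)
    position-shift a j = toℕ-injective (begin
      toℕ ((toℕ (position a) + j) mod ℓ) ≡⟨ toℕ-fromℕ< (m%n<n (toℕ (position a) + j) ℓ) ⟩
      (toℕ (position a) + j) % ℓ         ≡⟨ cong (λ z → (z + j) % ℓ) (toℕ-position a) ⟩
      ((toℕ b + a) % ℓ + j) % ℓ          ≡⟨ %-shift (toℕ b + a) j ℓ ⟩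
      (toℕ b + a + j) % ℓ                ≡⟨ cong (_% ℓ) (+-assoc (toℕ b) a j) ⟩
      (toℕ b + (a + j)) % ℓ              ≡⟨ sym (toℕ-position (a + j)) ⟩
      toℕ (position (a + j)) ∎)
      where open ≡-Reasoning

    edge-at : ∀ a → Σ (Subset N) λ e → IsEdge H e ×
                (∀ x → x ∈ e → Σ (Fin k) λ j → v ((toℕ (position a) + toℕ j) mod ℓ) ≡ x) ×
                (∀ (j : Fin k) → v ((toℕ (position a) + toℕ j) mod ℓ) ∈ e)
    edge-at a = proj₂ (proj₂ C) (position a)

  u : ℕ → Fin N
  u s = v (position s)

  W : ℕ → Subset N
  W a = proj₁ (edge-at a)

  W-edge : ∀ a → IsEdge H (W a)
  W-edge a = proj₁ (proj₂ (edge-at a))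

  u-start : u 0 ≡ v b
  u-start = cong v (toℕ-injective (begin
    toℕ (position 0)    ≡⟨ toℕ-position 0 ⟩
    (toℕ b + 0) % ℓ     ≡⟨ cong (_% ℓ) (+-identityʳ (toℕ b)) ⟩
    toℕ b % ℓ           ≡⟨ m<n⇒m%n≡m (toℕ<n b) ⟩
    toℕ b ∎))
    where open ≡-Reasoning

  u-periodic : ∀ s → u (s + ℓ) ≡ u s
  u-periodic s = cong v (toℕ-injective (begin
    toℕ (position (s + ℓ)) ≡⟨ toℕ-position (s + ℓ) ⟩
    (toℕ b + (s + ℓ)) % ℓ  ≡⟨ cong (_% ℓ) (sym (+-assoc (toℕ b) s ℓ)) ⟩
    (toℕ b + s + ℓ) % ℓ    ≡⟨ [m+n]%n≡m%n (toℕ b + s) ℓ ⟩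
    (toℕ b + s) % ℓ        ≡⟨ sym (toℕ-position s) ⟩
    toℕ (position s) ∎))
    where open ≡-Reasoning

  u-reduce : ∀ s → ℓ ≤ s → u s ≡ u (s ∸ ℓ)
  u-reduce s ℓ≤s = trans (cong u (sym (m∸n+n≡m ℓ≤s))) (u-periodic (s ∸ ℓ))

  u-distinct : ∀ {s s′} → s < s′ → s′ < s + ℓ → u s ≢ u s′
  u-distinct {s} {s′} s<s′ s′<s+ℓ us≡us′ = %-shift-injective (toℕ b + s) d ℓ (m<n⇒0<n∸m s<s′) d<ℓ (begin
      (toℕ b + s) % ℓ        ≡⟨ sym (toℕ-position s) ⟩
      toℕ (position s)       ≡⟨ cong toℕ (v-injective us≡us′) ⟩
      toℕ (position s′)      ≡⟨ toℕ-position s′ ⟩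
      (toℕ b + s′) % ℓ       ≡⟨ cong (λ z → (toℕ b + z) % ℓ) (sym s+d≡s′) ⟩
      (toℕ b + (s + d)) % ℓ  ≡⟨ cong (_% ℓ) (sym (+-assoc (toℕ b) s d)) ⟩
      (toℕ b + s + d) % ℓ ∎)
    where
    open ≡-Reasoning
    d = s′ ∸ s
    s+d≡s′ : s + d ≡ s′
    s+d≡s′ = m+[n∸m]≡n (<⇒≤ s<s′)
    d<ℓ : d < ℓ
    d<ℓ = +-cancelˡ-< s d ℓ (subst (_< s + ℓ) (sym s+d≡s′) s′<s+ℓ)

  u-injective : ∀ {s s′} → s < ℓ → s′ < ℓ → u s ≡ u s′ → s ≡ s′
  u-injective {s} {s′} s<ℓ s′<ℓ us≡us′ with <-cmp s s′
  ... | tri< s<s′ _ _ = ⊥-elim (u-distinct s<s′ (<-≤-trans s′<ℓ (m≤n+m ℓ s)) us≡us′)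
  ... | tri≈ _ s≡s′ _ = s≡s′
  ... | tri> _ _ s′<s = ⊥-elim (u-distinct s′<s (<-≤-trans s<ℓ (m≤n+m ℓ s′)) (sym us≡us′))

  window⁺ : ∀ {a s} → a ≤ s → s < a + k → u s ∈ W a
  window⁺ {a} {s} a≤s s<a+k = subst (_∈ W a) (cong v (trans (cong (λ z → (toℕ (position a) + z) mod ℓ) (toℕ-fromℕ< j<k))
                                                              (trans (position-shift a j) (cong position (m+[n∸m]≡n a≤s)))))
                                 (proj₂ (proj₂ (proj₂ (edge-at a))) (fromℕ< j<k))
    where
    j = s ∸ a
    j<k : j < k
    j<k = +-cancelˡ-< a j k (subst (_< a + k) (sym (m+[n∸m]≡n a≤s)) s<a+k)

  window⁻ : ∀ {a x} → x ∈ W a → Σ ℕ λ s → a ≤ s × s < a + k × u s ≡ x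
  window⁻ {a} {x} x∈Wa with proj₁ (proj₂ (proj₂ (edge-at a))) x x∈Wa
  ... | j , vj≡x = a + toℕ j , m≤m+n a (toℕ j) , +-monoʳ-< a (toℕ<n j) ,
                   trans (cong v (sym (position-shift a (toℕ j)))) vj≡x

  window-vertex : ∀ {a x} → x ∈ W a → Σ (Fin ℓ) λ i → v i ≡ x
  window-vertex x∈ with window⁻ x∈
  ... | s , _ , _ , us≡x = position s , us≡x

  u-leaves : ∀ a → u a ∉ W (suc a)
  u-leaves a ua∈ with window⁻ ua∈
  ... | s , a<s , s<a+1+k , us≡ua = u-distinct a<s (<-≤-trans s<a+1+k (subst (_≤ a + ℓ) (+-suc a k) (+-monoʳ-≤ a k<ℓ))) (sym us≡ua)

  leaving-unique : ∀ {a x} → x ∈ W a → x ∉ W (suc a) → x ≡ u a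
  leaving-unique {a} x∈Wa x∉Wa+1 with window⁻ x∈Wa
  ... | s , a≤s , s<a+k , us≡x with m≤n⇒m<n∨m≡n a≤s
  ...   | inj₁ a<s = ⊥-elim (x∉Wa+1 (subst (_∈ W (suc a)) us≡x (window⁺ a<s (<-≤-trans s<a+k (n≤1+n (a + k))))))
  ...   | inj₂ a≡s = trans (sym us≡x) (cong u (sym a≡s))

  W-step-distinct : 0 < k → ∀ a → W a ≢ W (suc a)
  W-step-distinct 0<k a Wa≡Wa+1 = u-leaves a (subst (u a ∈_) Wa≡Wa+1 (window⁺ ≤-refl (m<m+n a 0<k)))

  W-two-step-distinct : 1 < k → ∀ a → W a ≢ W (2 + a)
  W-two-step-distinct 1<k a Wa≡Wa+2 = u-leaves (suc a) (subst (u (suc a) ∈_) Wa≡Wa+2 (window⁺ (n≤1+n a) a+1<a+k))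
    where
    a+1<a+k : suc a < a + k
    a+1<a+k = subst (_< a + k) (+-comm a 1) (+-monoʳ-< a 1<k)

  start-outside : ∀ {a} → 0 < a → a + k ≤ ℓ → u 0 ∉ W a
  start-outside {a} 0<a a+k≤ℓ u0∈Wa with window⁻ u0∈Wa
  ... | s , a≤s , s<a+k , us≡u0 = u-distinct (<-≤-trans 0<a a≤s) (<-≤-trans s<a+k a+k≤ℓ) (sym us≡u0)

  around-start : ∀ d r → k + d ≡ ℓ → 0 < r → r ≤ k →
    u 0 ∈ W (r + d) ×
    (∀ {x} → x ∈ W (r + d) → x ≡ u 0 ⊎ Σ ℕ λ s → 0 < s × s < ℓ × (s < r ⊎ r + d ≤ s) × u s ≡ x)
  around-start d r k+d≡ℓ 0<r r≤k = start∈ , classify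
    where
    r+d≤ℓ : r + d ≤ ℓ
    r+d≤ℓ = subst (r + d ≤_) k+d≡ℓ (+-monoˡ-≤ d r≤k)
    ℓ+r≡r+d+k : ℓ + r ≡ r + d + k
    ℓ+r≡r+d+k = trans (cong (_+ r) (sym k+d≡ℓ)) (trans (+-comm (k + d) r) (trans (cong (r +_) (+-comm k d)) (sym (+-assoc r d k))))
    start∈ : u 0 ∈ W (r + d)
    start∈ = subst (_∈ W (r + d)) (u-periodic 0) (window⁺ r+d≤ℓ (subst (ℓ <_) ℓ+r≡r+d+k (m<m+n ℓ 0<r)))
    classify : ∀ {x} → x ∈ W (r + d) → x ≡ u 0 ⊎ Σ ℕ λ s → 0 < s × s < ℓ × (s < r ⊎ r + d ≤ s) × u s ≡ x
    classify x∈ with window⁻ x∈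
    ... | s , r+d≤s , s<r+d+k , us≡x with <-cmp s ℓ
    ...   | tri< s<ℓ _ _ = inj₂ (s , <-≤-trans (<-≤-trans 0<r (m≤m+n r d)) r+d≤s , s<ℓ , inj₂ r+d≤s , us≡x)
    ...   | tri≈ _ s≡ℓ _ = inj₁ (trans (sym us≡x) (trans (cong u (trans s≡ℓ (sym (+-identityˡ ℓ)))) (u-periodic 0)))
    ...   | tri> _ _ ℓ<s = inj₂ (s ∸ ℓ , m<n⇒0<n∸m ℓ<s , <-≤-trans s∸ℓ<r (≤-trans r≤k (<⇒≤ k<ℓ)) , inj₁ s∸ℓ<r ,
                             trans (sym (u-reduce s (<⇒≤ ℓ<s))) us≡x)
      where
      s∸ℓ<r : s ∸ ℓ < r
      s∸ℓ<r = +-cancelʳ-< ℓ (s ∸ ℓ) r (subst₂ _<_ (sym (m∸n+n≡m (<⇒≤ ℓ<s))) (trans (sym ℓ+r≡r+d+k) (+-comm ℓ r)) s<r+d+k)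

  omit-one : ℓ ≡ suc k → ∀ {y} → y ∈ W 1 →
    Σ ℕ λ a → u 0 ∈ W a × (∀ {x} → x ∈ W a → x ≡ u 0 ⊎ (x ∈ W 1 × x ≢ y))
  omit-one ℓ≡k+1 {y} y∈W1 with window⁻ y∈W1
  ... | t , 1≤t , t<1+k , ut≡y = t + 1 , proj₁ around , others
    where
    around : u 0 ∈ W (t + 1) ×
             (∀ {x} → x ∈ W (t + 1) → x ≡ u 0 ⊎ Σ ℕ λ s → 0 < s × s < ℓ × (s < t ⊎ t + 1 ≤ s) × u s ≡ x)
    around = around-start 1 t (trans (+-comm k 1) (sym ℓ≡k+1)) 1≤t (s≤s⁻¹ t<1+k)
    others : ∀ {x} → x ∈ W (t + 1) → x ≡ u 0 ⊎ (x ∈ W 1 × x ≢ y)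
    others x∈ with proj₂ around x∈
    ... | inj₁ x≡u0 = inj₁ x≡u0
    ... | inj₂ (s , 0<s , s<ℓ , gap , us≡x) =
          inj₂ (subst (_∈ W 1) us≡x (window⁺ 0<s (subst (s <_) ℓ≡k+1 s<ℓ)) ,
                λ x≡y → s≢t gap (u-injective s<ℓ (subst (t <_) (sym ℓ≡k+1) t<1+k)
                                   (trans us≡x (trans x≡y (sym ut≡y)))))
      where
      s≢t : s < t ⊎ t + 1 ≤ s → s ≢ t
      s≢t (inj₁ s<t) refl = <-irrefl refl s<t
      s≢t (inj₂ t+1≤s) refl = 1+n≰n (subst (_≤ s) (+-comm s 1) t+1≤s)

  module Length+2 (ℓ≡k+2 : ℓ ≡ suc (suc k)) where

    in-both : ∀ {s} → 2 ≤ s → s ≤ k → u s ∈ W 1 × u s ∈ W 2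
    in-both 2≤s s≤k = window⁺ (≤-trans (n≤1+n 1) 2≤s) (s≤s s≤k) , window⁺ 2≤s (s≤s (≤-trans s≤k (n≤1+n k)))

    omit-pair : ∀ {r} → 2 ≤ r → suc r ≤ k →
      u 0 ∈ W (r + 2) × (∀ {x} → x ∈ W (r + 2) → x ≡ u 0 ⊎ ((x ∈ W 1 ⊎ x ∈ W 2) × x ≢ u r × x ≢ u (suc r)))
    omit-pair {r} 2≤r r+1≤k = proj₁ around , others
      where
      around : u 0 ∈ W (r + 2) ×
               (∀ {x} → x ∈ W (r + 2) → x ≡ u 0 ⊎ Σ ℕ λ s → 0 < s × s < ℓ × (s < r ⊎ r + 2 ≤ s) × u s ≡ x)
      around = around-start 2 r (trans (+-comm k 2) (sym ℓ≡k+2)) (≤-trans (s≤s z≤n) 2≤r) (≤-trans (n≤1+n r) r+1≤k)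
      r+1<ℓ : suc r < ℓ
      r+1<ℓ = subst (suc r <_) (sym ℓ≡k+2) (≤-trans (s≤s r+1≤k) (n≤1+n (suc k)))
      in-union : ∀ {s} → 0 < s → s < ℓ → u s ∈ W 1 ⊎ u s ∈ W 2
      in-union {s} 0<s s<ℓ with s <? suc k
      ... | yes s<k+1 = inj₁ (window⁺ 0<s s<k+1)
      ... | no s≮k+1 = inj₂ (window⁺ (≤-trans (s≤s (≤-trans (s≤s z≤n) (≤-trans 2≤r (≤-trans (n≤1+n r) r+1≤k)))) (≮⇒≥ s≮k+1)) (subst (s <_) ℓ≡k+2 s<ℓ))
      others : ∀ {x} → x ∈ W (r + 2) → x ≡ u 0 ⊎ ((x ∈ W 1 ⊎ x ∈ W 2) × x ≢ u r × x ≢ u (suc r))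
      others x∈ with proj₂ around x∈
      ... | inj₁ x≡u0 = inj₁ x≡u0
      ... | inj₂ (s , 0<s , s<ℓ , gap , us≡x) = inj₂ (Data.Sum.map (subst (_∈ W 1) us≡x) (subst (_∈ W 2) us≡x) (in-union 0<s s<ℓ) ,
              (λ x≡ur → outside-gap gap (u-injective s<ℓ (<-trans (n<1+n r) r+1<ℓ) (trans us≡x x≡ur)) (inj₁ refl)) ,
              (λ x≡ur+1 → outside-gap gap (u-injective s<ℓ r+1<ℓ (trans us≡x x≡ur+1)) (inj₂ refl)))
        where
        outside-gap : ∀ {s} → s < r ⊎ r + 2 ≤ s → ∀ {s′} → s ≡ s′ → s′ ≡ r ⊎ s′ ≡ suc r → ⊥
        outside-gap (inj₁ s<r) refl (inj₁ refl) = <-irrefl refl s<r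
        outside-gap (inj₁ s<r) refl (inj₂ refl) = <-asym s<r (n<1+n r)
        outside-gap (inj₂ r+2≤s) refl (inj₁ refl) = <-irrefl refl (<-≤-trans (m<m+n r (s≤s z≤n)) r+2≤s)
        outside-gap (inj₂ r+2≤s) refl (inj₂ refl) = 1+n≰n (subst (_≤ suc r) (+-comm r 2) r+2≤s)

    omit-two : 2 < k → ∀ {y} → y ∈ W 1 → y ∈ W 2 →
      Σ (Fin N) λ w → (w ∈ W 1 × w ∈ W 2 × w ≢ y) ×
      Σ ℕ λ a → u 0 ∈ W a × (∀ {x} → x ∈ W a → x ≡ u 0 ⊎ ((x ∈ W 1 ⊎ x ∈ W 2) × x ≢ y × x ≢ w))
    omit-two 2<k {y} y∈W1 y∈W2 = finish (locate (window⁻ y∈W1))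
      where
      next-distinct : ∀ s → u s ≢ u (suc s)
      next-distinct s = u-distinct (n<1+n s) (subst (_< s + ℓ) (+-comm s 1)
                          (+-monoʳ-< s (subst (1 <_) (sym ℓ≡k+2) (s≤s (s≤s z≤n)))))

      locate : (Σ ℕ λ t → 1 ≤ t × t < 1 + k × u t ≡ y) →
               Σ ℕ λ r → 2 ≤ r × suc r ≤ k × (u r ≡ y ⊎ u (suc r) ≡ y)
      locate (1 , _ , _ , u1≡y) = ⊥-elim (u-leaves 1 (subst (_∈ W 2) (sym u1≡y) y∈W2))
      locate (suc (suc t) , _ , t+2<k+1 , ut+2≡y) with m≤n⇒m<n∨m≡n (s≤s⁻¹ t+2<k+1)
      ... | inj₁ t+2<k = suc (suc t) , s≤s (s≤s z≤n) , t+2<k , inj₁ ut+2≡y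
      ... | inj₂ t+2≡k = suc t , s≤s⁻¹ (subst (2 <_) (sym t+2≡k) 2<k) , ≤-reflexive t+2≡k , inj₂ ut+2≡y

      finish : (Σ ℕ λ r → 2 ≤ r × suc r ≤ k × (u r ≡ y ⊎ u (suc r) ≡ y)) →
        Σ (Fin N) λ w → (w ∈ W 1 × w ∈ W 2 × w ≢ y) ×
        Σ ℕ λ a → u 0 ∈ W a × (∀ {x} → x ∈ W a → x ≡ u 0 ⊎ ((x ∈ W 1 ⊎ x ∈ W 2) × x ≢ y × x ≢ w))
      finish (r , 2≤r , r+1≤k , inj₁ ur≡y) =
        let (w∈W₁ , w∈W₂) = in-both (≤-trans 2≤r (n≤1+n r)) r+1≤k
            (u0∈ , others) = omit-pair 2≤r r+1≤k
        in u (suc r) , (w∈W₁ , w∈W₂ , λ w≡y → next-distinct r (trans ur≡y (sym w≡y))) , r + 2 , u0∈ ,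
           λ x∈ → Data.Sum.map₂ (λ (x∈∪ , x≢ur , x≢ur+1) → x∈∪ , (λ x≡y → x≢ur (trans x≡y (sym ur≡y))) , x≢ur+1) (others x∈)
      finish (r , 2≤r , r+1≤k , inj₂ ur+1≡y) =
        let (w∈W₁ , w∈W₂) = in-both 2≤r (≤-trans (n≤1+n r) r+1≤k)
            (u0∈ , others) = omit-pair 2≤r r+1≤k
        in u r , (w∈W₁ , w∈W₂ , λ w≡y → next-distinct r (trans w≡y (sym ur+1≡y))) , r + 2 , u0∈ ,
           λ x∈ → Data.Sum.map₂ (λ (x∈∪ , x≢ur , x≢ur+1) → x∈∪ , (λ x≡y → x≢ur+1 (trans x≡y (sym ur+1≡y))) , x≢ur) (others x∈)

  consecutive-windows : ∀ a → AtMostOneOutside (W a) (W (suc a))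
  consecutive-windows a x∈ x∉ y∈ y∉ = trans (leaving-unique x∈ x∉) (sym (leaving-unique y∈ y∉))

-- The gadget, for k ≥ 3 and n ≥ 2k, on the vertices {0, ..., n}:
--   F consists of A = {1..k}, B = {1..k-1, k+1} and, for 1 < q < k,
--     E q = {2..k+1} ∖ {q} ∪ {k+q};
--   G consists of the star edges D₀ = {0..k-1} and, for 1 < q < k,
--     D q = {0..k+1} ∖ {1, q}.
module Gadget (k : ℕ) (2<k : 2 < k) (n : ℕ) (2k≤n : k + k ≤ n) where

  open Counting
  open NumberSets
  open import Data.Nat using (_<_; _∸_; s≤s; z≤n; s≤s⁻¹; z<s)
  open import Data.Nat.Properties
  open import Data.Bool using (T; _∧_; _∨_; not)
  open import Data.Vec using (_∷_; here)
  open import Data.List using (List; _∷_; applyUpTo; length)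
  open import Data.List.Membership.Propositional.Properties using (∈-applyUpTo⁺; ∈-applyUpTo⁻)
  open import Data.List.Properties using (length-applyUpTo)
  open import Data.List.Relation.Unary.Any using (here; there)
  open import Data.List.Relation.Unary.AllPairs using (AllPairs; _∷_)
  open import Data.List.Relation.Unary.All using (_∷_)
  import Data.List.Relation.Unary.All.Properties as All
  import Data.List.Relation.Unary.AllPairs.Properties as AllPairs
  open import Data.Fin using (toℕ; fromℕ<) renaming (zero to fzero)
  open import Data.Fin.Properties using (toℕ-injective; toℕ-fromℕ<; any?)
  open import Data.Product using (_,_; proj₁; proj₂)
  open import Data.Sum using (_⊎_; inj₁; inj₂; [_,_]′)
  open import Data.Empty using (⊥; ⊥-elim)
  open import Relation.Binary.PropositionalEquality
  open import Relation.Nullary using (¬_; yes; no; Dec)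
  open import Function using (_∘_)
  import Data.Sum
  import Data.Fin

  N : ℕ
  N = suc n

  inA inB inD₀ inV : ℕ → Bool
  inA = delete 0 (below (suc k))
  inB = insert (suc k) (delete 0 (below k))
  inD₀ = below k
  inV = delete 0 (below (k + k))

  inE inD : ℕ → ℕ → Bool
  inE q = insert (k + q) (delete q (delete 1 (delete 0 (below (2 + k)))))
  inD q = delete q (delete 1 (below (2 + k)))

  A B D₀ V : Subset N
  A = select inA
  B = select inB
  D₀ = select inD₀
  V = select inV

  E D : ℕ → Subset N
  E q = select (inE q)
  D q = select (inD q)

  F-list G-list : List (Subset N)
  F-list = A ∷ B ∷ applyUpTo (λ i → E (2 + i)) (k ∸ 2)
  G-list = D₀ ∷ applyUpTo (λ i → D (2 + i)) (k ∸ 2)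

  F G H′ : Hypergraph N
  F = listed F-list
  G = listed G-list
  H′ = (fullStar k n ∖ G) ∪ F

  inA⁻ : ∀ {t} → T (inA t) → 0 < t × t ≤ k
  inA⁻ t∈ with delete⁻ 0 (below (suc k)) t∈
  ... | t<k+1 , t≢0 = n≢0⇒n>0 t≢0 , s≤s⁻¹ (below⁻ t<k+1)

  inA⁺ : ∀ {t} → 0 < t → t ≤ k → T (inA t)
  inA⁺ 0<t t≤k = delete⁺ 0 (below (suc k)) (below⁺ (s≤s t≤k)) (>⇒≢ 0<t)

  inB⁻ : ∀ {t} → T (inB t) → (0 < t × t < k) ⊎ t ≡ suc k
  inB⁻ t∈ with insert⁻ (suc k) (delete 0 (below k)) t∈
  ... | inj₂ t≡k+1 = inj₂ t≡k+1
  ... | inj₁ t∈′ with delete⁻ 0 (below k) t∈′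
  ...   | t<k , t≢0 = inj₁ (n≢0⇒n>0 t≢0 , below⁻ t<k)

  inB⁺ : ∀ {t} → 0 < t → t < k → T (inB t)
  inB⁺ 0<t t<k = insert⁺ (suc k) (delete 0 (below k)) (delete⁺ 0 (below k) (below⁺ t<k) (>⇒≢ 0<t))

  inB-top : T (inB (suc k))
  inB-top = insert-self (suc k) (delete 0 (below k))

  inE⁻ : ∀ q {t} → T (inE q t) → (1 < t × t ≤ suc k × t ≢ q) ⊎ t ≡ k + q
  inE⁻ q t∈ with insert⁻ (k + q) (delete q (delete 1 (delete 0 (below (2 + k))))) t∈
  ... | inj₂ t≡k+q = inj₂ t≡k+q
  ... | inj₁ t∈₃ with delete⁻ q (delete 1 (delete 0 (below (2 + k)))) t∈₃
  ...   | t∈₂ , t≢q with delete⁻ 1 (delete 0 (below (2 + k))) t∈₂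
  ...     | t∈₁ , t≢1 with delete⁻ 0 (below (2 + k)) t∈₁
  ...       | t<k+2 , t≢0 = inj₁ (≤∧≢⇒< (n≢0⇒n>0 t≢0) (≢-sym t≢1) , s≤s⁻¹ (below⁻ t<k+2) , t≢q)

  inE-top : ∀ q → T (inE q (k + q))
  inE-top q = insert-self (k + q) (delete q (delete 1 (delete 0 (below (2 + k)))))

  inE⁺ : ∀ q {t} → 1 < t → t ≤ suc k → t ≢ q → T (inE q t)
  inE⁺ q {t} 1<t t≤k+1 t≢q =
    insert⁺ (k + q) (delete q (delete 1 (delete 0 (below (2 + k))))) {t}
      (delete⁺ q (delete 1 (delete 0 (below (2 + k)))) {t}
        (delete⁺ 1 (delete 0 (below (2 + k)))
          (delete⁺ 0 (below (2 + k)) (below⁺ (s≤s t≤k+1)) (>⇒≢ (<-trans z<s 1<t)))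
          (>⇒≢ 1<t))
        t≢q)

  inD⁻ : ∀ q {t} → T (inD q t) → t ≢ 1 × t < 2 + k × t ≢ q
  inD⁻ q t∈ with delete⁻ q (delete 1 (below (2 + k))) t∈
  ... | t∈′ , t≢q with delete⁻ 1 (below (2 + k)) t∈′
  ...   | t<k+2 , t≢1 = t≢1 , below⁻ t<k+2 , t≢q

  inD⁺ : ∀ q {t} → t ≢ 1 → t < 2 + k → t ≢ q → T (inD q t)
  inD⁺ q t≢1 t<k+2 t≢q = delete⁺ q (delete 1 (below (2 + k))) (delete⁺ 1 (below (2 + k)) (below⁺ t<k+2) t≢1) t≢q

  inV⁺ : ∀ {t} → 0 < t → t < k + k → T (inV t)
  inV⁺ 0<t t<2k = delete⁺ 0 (below (k + k)) (below⁺ t<2k) (>⇒≢ 0<t)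

  2≤k : 2 ≤ k
  2≤k = <⇒≤ 2<k

  0<k : 0 < k
  0<k = ≤-trans (s≤s z≤n) 2≤k

  k≤2k : k ≤ k + k
  k≤2k = m≤m+n k k

  2+k≤2k : 2 + k ≤ k + k
  2+k≤2k = subst (_≤ k + k) (+-comm k 2) (+-monoʳ-≤ k 2≤k)

  1≤2k : 1 ≤ k + k
  1≤2k = ≤-trans 0<k k≤2k

  k+q≤2k : ∀ {q} → q < k → k + q ≤ k + k
  k+q≤2k q<k = +-monoʳ-≤ k (<⇒≤ q<k)

  1+k≤2k : suc k ≤ k + k
  1+k≤2k = ≤-trans (n≤1+n (suc k)) 2+k≤2k

  <N : ∀ {t} → t ≤ k + k → t < N
  <N t≤2k = s≤s (≤-trans t≤2k 2k≤n)

  vertex : ∀ t → t ≤ k + k → Fin N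
  vertex t t≤2k = fromℕ< (<N t≤2k)

  vertex∈ : ∀ g {t} (t≤2k : t ≤ k + k) → T (g t) → vertex t t≤2k ∈ select g
  vertex∈ g t≤2k gt = select⁺ g (subst (λ s → T (g s)) (sym (toℕ-fromℕ< (<N t≤2k))) gt)

  vertex∉ : ∀ g {t} (t≤2k : t ≤ k + k) → ¬ T (g t) → vertex t t≤2k ∉ select g
  vertex∉ g t≤2k t∉g v∈ = t∉g (subst (λ s → T (g s)) (toℕ-fromℕ< (<N t≤2k)) (select⁻ g v∈))

  ≢vertex : ∀ {x : Fin N} {t} (t≤2k : t ≤ k + k) → x ≢ vertex t t≤2k → toℕ x ≢ t
  ≢vertex t≤2k x≢v x≡t = x≢v (toℕ-injective (trans x≡t (sym (toℕ-fromℕ< (<N t≤2k)))))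

  differ : ∀ g g′ {t} → t ≤ k + k → T (g t) → ¬ T (g′ t) → select {N} g ≢ select g′
  differ g g′ t≤2k gt t∉g′ g≡g′ = vertex∉ g′ t≤2k t∉g′ (subst (vertex _ t≤2k ∈_) g≡g′ (vertex∈ g t≤2k gt))

  ∣A∣ : ∣ A ∣ ≡ k
  ∣A∣ = suc-injective (begin
    suc ∣ A ∣                       ≡⟨ cong suc (∣select∣ N inA) ⟩
    suc (countBelow N inA)          ≡⟨ countBelow-delete N 0 (below (suc k)) _ z<s ⟩
    countBelow N (below (suc k))    ≡⟨ countBelow-below N (suc k) (<⇒≤ (<N 1+k≤2k)) ⟩
    suc k ∎)
    where open ≡-Reasoning

  ∣B∣ : ∣ B ∣ ≡ k
  ∣B∣ = begin
    ∣ B ∣                                                ≡⟨ ∣select∣ N inB ⟩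
    countBelow N (insert (suc k) (delete 0 (below k)))   ≡⟨ countBelow-insert N (suc k) (delete 0 (below k)) k+1∉ (<N 1+k≤2k) ⟩
    suc (countBelow N (delete 0 (below k)))              ≡⟨ countBelow-delete N 0 (below k) (below⁺ 0<k) z<s ⟩
    countBelow N (below k)                               ≡⟨ countBelow-below N k (<⇒≤ (<N k≤2k)) ⟩
    k ∎
    where
    open ≡-Reasoning
    k+1∉ : ¬ T (delete 0 (below k) (suc k))
    k+1∉ k+1∈ = <-asym (below⁻ (proj₁ (delete⁻ 0 (below k) k+1∈))) (n<1+n k)

  ∣D₀∣ : ∣ D₀ ∣ ≡ k
  ∣D₀∣ = trans (∣select∣ N inD₀) (countBelow-below N k (<⇒≤ (<N k≤2k)))

  ∣E∣ : ∀ {q} → 1 < q → q < k → ∣ E q ∣ ≡ k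
  ∣E∣ {q} 1<q q<k = suc-injective (suc-injective (begin
    suc (suc ∣ E q ∣)                   ≡⟨ cong (2 +_) (trans (∣select∣ N (inE q)) (countBelow-insert N (k + q) g₃ k+q∉ (<N (k+q≤2k q<k)))) ⟩
    suc (suc (suc (countBelow N g₃)))   ≡⟨ cong (2 +_) (countBelow-delete N q g₂ q∈g₂ (<N (≤-trans (<⇒≤ q<k) k≤2k))) ⟩
    suc (suc (countBelow N g₂))         ≡⟨ cong suc (countBelow-delete N 1 g₁ (delete⁺ 0 g₀ {1} (below⁺ {2 + k} {1} (s≤s (s≤s z≤n))) λ ()) (<N (≤-trans 0<k k≤2k))) ⟩
    suc (countBelow N g₁)               ≡⟨ countBelow-delete N 0 g₀ (below⁺ {2 + k} {0} z<s) z<s ⟩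
    countBelow N g₀                     ≡⟨ countBelow-below N (2 + k) (<⇒≤ (<N 2+k≤2k)) ⟩
    2 + k ∎))
    where
    open ≡-Reasoning
    g₀ = below (2 + k)
    g₁ = delete 0 g₀
    g₂ = delete 1 g₁
    g₃ = delete q g₂
    q∈g₂ : T (g₂ q)
    q∈g₂ = delete⁺ 1 g₁ (delete⁺ 0 g₀ (below⁺ (<-≤-trans q<k (≤-trans (n≤1+n k) (n≤1+n (suc k))))) (>⇒≢ (<-trans z<s 1<q))) (>⇒≢ 1<q)
    k+q∉ : ¬ T (g₃ (k + q))
    k+q∉ k+q∈ = <-irrefl refl (<-≤-trans (subst (k + q <_) (+-comm 2 k)
                  (below⁻ {t = k + q} (proj₁ (delete⁻ 0 g₀ {k + q} (proj₁ (delete⁻ 1 g₁ {k + q} (proj₁ (delete⁻ q g₂ {k + q} k+q∈))))))))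
                  (+-monoʳ-≤ k 1<q))

  ∣D∣ : ∀ {q} → 1 < q → q < k → ∣ D q ∣ ≡ k
  ∣D∣ {q} 1<q q<k = suc-injective (suc-injective (begin
    suc (suc ∣ D q ∣)                    ≡⟨ cong (2 +_) (∣select∣ N (inD q)) ⟩
    suc (suc (countBelow N (inD q)))     ≡⟨ cong suc (countBelow-delete N q g₁ q∈g₁ (<N (≤-trans (<⇒≤ q<k) k≤2k))) ⟩
    suc (countBelow N g₁)                ≡⟨ countBelow-delete N 1 g₀ (below⁺ {2 + k} {1} (s≤s (s≤s z≤n))) (<N (≤-trans 0<k k≤2k)) ⟩
    countBelow N g₀                      ≡⟨ countBelow-below N (2 + k) (<⇒≤ (<N 2+k≤2k)) ⟩
    2 + k ∎))
    where
    open ≡-Reasoning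
    g₀ = below (2 + k)
    g₁ = delete 1 g₀
    q∈g₁ : T (g₁ q)
    q∈g₁ = delete⁺ 1 g₀ (below⁺ (<-≤-trans q<k (≤-trans (n≤1+n k) (n≤1+n (suc k))))) (>⇒≢ 1<q)

  ∣V∣ : ∣ V ∣ ≤ k + k
  ∣V∣ = subst (_≤ k + k) (sym (∣select∣ N inV)) (≤-trans (n≤1+n _) (≤-reflexive (begin
    suc (countBelow N inV)          ≡⟨ countBelow-delete N 0 (below (k + k)) (below⁺ {k + k} {0} (<-≤-trans z<s 2+k≤2k)) z<s ⟩
    countBelow N (below (k + k))    ≡⟨ countBelow-below N (k + k) (<⇒≤ (<N ≤-refl)) ⟩
    k + k ∎)))
    where open ≡-Reasoning

  index-range : ∀ {i} → i < k ∸ 2 → 1 < 2 + i × 2 + i < k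
  index-range {i} i<k-2 = s≤s (s≤s z≤n) , subst (2 + i <_) (m+[n∸m]≡n 2≤k) (+-monoʳ-< 2 i<k-2)

  index-of : ∀ {q} → 1 < q → q < k → q ∸ 2 < k ∸ 2
  index-of {suc (suc q)} (s≤s (s≤s _)) q<k = ∸-monoˡ-< q<k (s≤s (s≤s z≤n))

  F-cases : ∀ e → T (F e) → e ≡ A ⊎ e ≡ B ⊎ Σ ℕ λ q → (1 < q × q < k) × e ≡ E q
  F-cases e e∈ with listed⁻ F-list e∈
  ... | here e≡A = inj₁ e≡A
  ... | there (here e≡B) = inj₂ (inj₁ e≡B)
  ... | there (there e∈Es) with ∈-applyUpTo⁻ (λ i → E (2 + i)) e∈Es
  ...   | i , i<k-2 , e≡E = inj₂ (inj₂ (2 + i , index-range i<k-2 , e≡E))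

  G-cases : ∀ e → T (G e) → e ≡ D₀ ⊎ Σ ℕ λ q → (1 < q × q < k) × e ≡ D q
  G-cases e e∈ with listed⁻ G-list e∈
  ... | here e≡D₀ = inj₁ e≡D₀
  ... | there e∈Ds with ∈-applyUpTo⁻ (λ i → D (2 + i)) e∈Ds
  ...   | i , i<k-2 , e≡D = inj₂ (2 + i , index-range i<k-2 , e≡D)

  D₀∈G : T (G D₀)
  D₀∈G = listed⁺ G-list (here refl)

  D∈G : ∀ {q} → 1 < q → q < k → T (G (D q))
  D∈G {suc (suc q)} (s≤s (s≤s _)) q<k = listed⁺ G-list (there (∈-applyUpTo⁺ (λ i → D (2 + i)) (index-of (s≤s (s≤s z≤n)) q<k)))

  1∉E : ∀ q → ¬ T (inE q 1)
  1∉E q 1∈ with inE⁻ q 1∈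
  ... | inj₁ (1<1 , _) = <-irrefl refl 1<1
  ... | inj₂ 1≡k+q = <-irrefl 1≡k+q (<-≤-trans 2≤k (m≤m+n k q))

  q∉E : ∀ {q} → 0 < q → ¬ T (inE q q)
  q∉E {q} 0<q q∈ with inE⁻ q q∈
  ... | inj₁ (_ , _ , q≢q) = q≢q refl
  ... | inj₂ q≡k+q = <-irrefl (trans q≡k+q (+-comm k q)) (m<m+n q 0<k)

  k+q∉E : ∀ {q q′} → 1 < q → q ≢ q′ → ¬ T (inE q′ (k + q))
  k+q∉E {q} {q′} 1<q q≢q′ k+q∈ with inE⁻ q′ k+q∈
  ... | inj₁ (_ , k+q≤k+1 , _) = <-irrefl refl (<-≤-trans (subst (_< k + q) (+-comm k 1) (+-monoʳ-< k 1<q)) k+q≤k+1)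
  ... | inj₂ k+q≡k+q′ = q≢q′ (+-cancelˡ-≡ k q q′ k+q≡k+q′)

  A≢B : A ≢ B
  A≢B = differ inA inB k≤2k (inA⁺ 0<k ≤-refl) λ k∈B → [ (λ (_ , k<k) → <-irrefl refl k<k) , (λ k≡k+1 → <-irrefl k≡k+1 (n<1+n k)) ]′ (inB⁻ k∈B)

  F-distinct : AllPairs _≢_ F-list
  F-distinct =
    (A≢B ∷ All.applyUpTo⁺₁ _ (k ∸ 2) (λ i<k-2 → differ inA (inE _) 1≤2k (inA⁺ {1} z<s 0<k) (1∉E _)))
    ∷ All.applyUpTo⁺₁ _ (k ∸ 2) (λ i<k-2 → differ inB (inE _) 1≤2k (inB⁺ {1} z<s 2≤k) (1∉E _))
    ∷ AllPairs.applyUpTo⁺₁ _ (k ∸ 2) (λ {i} {j} i<j j<k-2 → differ (inE (2 + i)) (inE (2 + j)) (k+q≤2k (proj₂ (index-range (<-trans i<j j<k-2))))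
                                          (inE-top (2 + i)) (k+q∉E (s≤s (s≤s z≤n)) (λ i≡j → <-irrefl (+-cancelˡ-≡ 2 _ _ i≡j) i<j)))

  G-distinct : AllPairs _≢_ G-list
  G-distinct =
    All.applyUpTo⁺₁ _ (k ∸ 2) (λ {i} _ → differ inD₀ (inD (2 + i)) (≤-trans 0<k k≤2k) (below⁺ {k} {1} 2≤k) (λ 1∈ → proj₁ (inD⁻ (2 + i) 1∈) refl))
    ∷ AllPairs.applyUpTo⁺₁ _ (k ∸ 2) (λ {i} {j} i<j j<k-2 → differ (inD (2 + i)) (inD (2 + j)) (≤-trans (<⇒≤ (proj₂ (index-range j<k-2))) k≤2k)
          (inD⁺ (2 + i) (λ ()) (<-≤-trans (proj₂ (index-range j<k-2)) (≤-trans (n≤1+n k) (n≤1+n (suc k)))) (λ j≡i → <-irrefl (sym (+-cancelˡ-≡ 2 j i j≡i)) i<j))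
          (λ q∈ → proj₂ (proj₂ (inD⁻ (2 + j) q∈)) refl))

  count-F : count F ≡ k
  count-F = begin
    count F                      ≡⟨ count-listed F-list F-distinct ⟩
    2 + length (applyUpTo _ (k ∸ 2)) ≡⟨ cong (2 +_) (length-applyUpTo _ (k ∸ 2)) ⟩
    2 + (k ∸ 2)                  ≡⟨ m+[n∸m]≡n 2≤k ⟩
    k ∎
    where open ≡-Reasoning

  count-G : count G ≡ 1 + (k ∸ 2)
  count-G = trans (count-listed G-list G-distinct) (cong suc (length-applyUpTo _ (k ∸ 2)))

  F-uniform : Uniform k F
  F-uniform e e∈F with F-cases e e∈F
  ... | inj₁ refl = ∣A∣
  ... | inj₂ (inj₁ refl) = ∣B∣
  ... | inj₂ (inj₂ (q , (1<q , q<k) , refl)) = ∣E∣ 1<q q<k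

  G-uniform : Uniform k G
  G-uniform e e∈G with G-cases e e∈G
  ... | inj₁ refl = ∣D₀∣
  ... | inj₂ (q , (1<q , q<k) , refl) = ∣D∣ 1<q q<k

  star⁺ : ∀ {e} → fzero ∈ e → ∣ e ∣ ≡ k → IsEdge (fullStar k n) e
  star⁺ {true ∷ e} here ∣e∣≡k = ≡⇒≡ᵇ _ k ∣e∣≡k

  star⁻ : ∀ e → IsEdge (fullStar k n) e → fzero ∈ e × ∣ e ∣ ≡ k
  star⁻ (true ∷ e) e∈ = here , ≡ᵇ⇒≡ _ k e∈

  F-avoids-centre : ∀ e → T (F e) → fzero ∉ e
  F-avoids-centre e e∈F with F-cases e e∈F
  ... | inj₁ refl = λ 0∈A → <-irrefl refl (proj₁ (inA⁻ (select⁻ inA 0∈A)))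
  ... | inj₂ (inj₁ refl) = λ 0∈B → [ (λ (0<0 , _) → <-irrefl refl 0<0) , (λ ()) ]′ (inB⁻ (select⁻ inB 0∈B))
  ... | inj₂ (inj₂ (q , _ , refl)) = λ 0∈E → [ (λ (1<0 , _) → <-irrefl refl (<-trans z<s 1<0)) , 0≢k+q ]′ (inE⁻ q (select⁻ (inE q) 0∈E))
    where
    0≢k+q : 0 ≢ k + q
    0≢k+q 0≡k+q = <-irrefl 0≡k+q (<-≤-trans 0<k (m≤m+n k q))

  D-contains-centre : ∀ {q} → 1 < q → fzero ∈ D q
  D-contains-centre {q} 1<q = select⁺ (inD q) (inD⁺ q (λ ()) z<s λ 0≡q → <-irrefl 0≡q (<-trans z<s 1<q))

  G⊑star : G ⊑ fullStar k n
  G⊑star e e∈G = star⁺ (centre∈ (G-cases e e∈G)) (G-uniform e e∈G)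
    where
    centre∈ : e ≡ D₀ ⊎ Σ ℕ (λ q → (1 < q × q < k) × e ≡ D q) → fzero ∈ e
    centre∈ (inj₁ refl) = select⁺ inD₀ (below⁺ {k} {0} 0<k)
    centre∈ (inj₂ (q , (1<q , _) , refl)) = D-contains-centre 1<q

  F∩star=∅ : ∀ e → T (F e) → ¬ IsEdge (fullStar k n) e
  F∩star=∅ e e∈F e∈star = F-avoids-centre e e∈F (proj₁ (star⁻ e e∈star))

  centre∉V : fzero ∉ V
  centre∉V 0∈V = proj₂ (delete⁻ 0 (below (k + k)) {0} (select⁻ inV 0∈V)) refl

  F⊆V : ∀ e → T (F e) → e ⊆ V
  F⊆V e e∈F {x} x∈e = select⁺ inV (inV⁺ (proj₁ bounds) (proj₂ bounds))
    where
    bounds : 0 < toℕ x × toℕ x < k + k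
    bounds with F-cases e e∈F
    ... | inj₁ refl = let (0<x , x≤k) = inA⁻ (select⁻ inA x∈e) in 0<x , <-≤-trans (s≤s x≤k) 1+k≤2k
    ... | inj₂ (inj₁ refl) with inB⁻ (select⁻ inB x∈e)
    ...   | inj₁ (0<x , x<k) = 0<x , <-≤-trans x<k k≤2k
    ...   | inj₂ x≡k+1 = subst (λ t → 0 < t × t < k + k) (sym x≡k+1) (z<s , 2+k≤2k)
    bounds | inj₂ (inj₂ (q , (_ , q<k) , refl)) with inE⁻ q (select⁻ (inE q) x∈e)
    ...   | inj₁ (1<x , x≤k+1 , _) = <-trans z<s 1<x , <-≤-trans (s≤s x≤k+1) 2+k≤2k
    ...   | inj₂ x≡k+q = subst (λ t → 0 < t × t < k + k) (sym x≡k+q) (<-≤-trans 0<k (m≤m+n k q) , +-monoʳ-< k q<k)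

  count-H′ : edges H′ ≡ edges (fullStar k n) + 1
  count-H′ = +-cancelʳ-≡ (1 + (k ∸ 2)) _ _ (begin
    edges H′ + (1 + (k ∸ 2))                   ≡⟨ cong₂ _+_ (edges≡count H′) (sym count-G) ⟩
    count H′ + count G                         ≡⟨ count-swap (fullStar k n) G F G⊑star F∩star=∅ ⟩
    count (fullStar k n) + count F             ≡⟨ cong₂ _+_ (sym (edges≡count (fullStar k n))) count-F ⟩
    edges (fullStar k n) + k                   ≡⟨ cong (edges (fullStar k n) +_) (sym (m+[n∸m]≡n 2≤k)) ⟩
    edges (fullStar k n) + (1 + (1 + (k ∸ 2))) ≡⟨ sym (+-assoc (edges (fullStar k n)) 1 (1 + (k ∸ 2))) ⟩
    edges (fullStar k n) + 1 + (1 + (k ∸ 2)) ∎)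
    where open ≡-Reasoning

  H′⁻ : ∀ e → T (H′ e) → T (F e) ⊎ (IsEdge (fullStar k n) e × ¬ T (G e))
  H′⁻ e = split {fullStar k n e} {G e} {F e}
    where
    split : ∀ {h g f} → T ((h ∧ not g) ∨ f) → T f ⊎ (T h × ¬ T g)
    split {true} {true} {true} _ = inj₁ _
    split {true} {false} {true} _ = inj₁ _
    split {false} {_} {true} _ = inj₁ _
    split {true} {false} {false} _ = inj₂ (_ , λ ())

  H′-uniform : ∀ e → T (H′ e) → ∣ e ∣ ≡ k
  H′-uniform e e∈ = [ F-uniform e , (λ (e∈star , _) → proj₂ (star⁻ e e∈star)) ]′ (H′⁻ e e∈)

  H′-avoiding-centre : ∀ e → T (H′ e) → fzero ∉ e → T (F e)
  H′-avoiding-centre e e∈ 0∉e = [ (λ e∈F → e∈F) , (λ (e∈star , _) → ⊥-elim (0∉e (proj₁ (star⁻ e e∈star)))) ]′ (H′⁻ e e∈)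

  no-G-cover : ∀ e Z → T (H′ e) → fzero ∈ e → T (G Z) → e ⊆ Z → ⊥
  no-G-cover e Z e∈ 0∈e Z∈G e⊆Z with ⊆-card-eq e Z e⊆Z (≤-reflexive (trans (G-uniform Z Z∈G) (sym (H′-uniform e e∈))))
  ... | refl = [ (λ e∈F → F-avoids-centre e e∈F 0∈e) , (λ (_ , e∉G) → e∉G Z∈G) ]′ (H′⁻ e e∈)

  private
    two-outside : ∀ g g′ {t₁ t₂} (t₁≤2k : t₁ ≤ k + k) (t₂≤2k : t₂ ≤ k + k) → t₁ ≢ t₂ →
      T (g t₁) → T (g t₂) → ¬ T (g′ t₁) → ¬ T (g′ t₂) → ¬ AtMostOneOutside (select g) (select g′)
    two-outside g g′ t₁≤2k t₂≤2k t₁≢t₂ t₁∈ t₂∈ t₁∉ t₂∉ one = t₁≢t₂ (begin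
      _                        ≡⟨ sym (toℕ-fromℕ< (<N t₁≤2k)) ⟩
      toℕ (vertex _ t₁≤2k)     ≡⟨ cong toℕ (one (vertex∈ g t₁≤2k t₁∈) (vertex∉ g′ t₁≤2k t₁∉) (vertex∈ g t₂≤2k t₂∈) (vertex∉ g′ t₂≤2k t₂∉)) ⟩
      toℕ (vertex _ t₂≤2k)     ≡⟨ toℕ-fromℕ< (<N t₂≤2k) ⟩
      _ ∎)
      where open ≡-Reasoning

  F-adjacent : ∀ X Y → T (F X) → T (F Y) → X ≢ Y → AtMostOneOutside X Y → (X ≡ A × Y ≡ B) ⊎ (X ≡ B × Y ≡ A)
  F-adjacent X Y X∈F Y∈F X≢Y one with F-cases X X∈F | F-cases Y Y∈F
  ... | inj₁ refl | inj₁ refl = ⊥-elim (X≢Y refl)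
  ... | inj₁ refl | inj₂ (inj₁ refl) = inj₁ (refl , refl)
  ... | inj₁ refl | inj₂ (inj₂ (q , (1<q , q<k) , refl)) =
        ⊥-elim (two-outside inA (inE q) 1≤2k (≤-trans (<⇒≤ q<k) k≤2k) (<⇒≢ 1<q)
                  (inA⁺ {1} z<s 0<k) (inA⁺ (<-trans z<s 1<q) (<⇒≤ q<k)) (1∉E q) (q∉E (<-trans z<s 1<q)) one)
  ... | inj₂ (inj₁ refl) | inj₁ refl = inj₂ (refl , refl)
  ... | inj₂ (inj₁ refl) | inj₂ (inj₁ refl) = ⊥-elim (X≢Y refl)
  ... | inj₂ (inj₁ refl) | inj₂ (inj₂ (q , (1<q , q<k) , refl)) =
        ⊥-elim (two-outside inB (inE q) 1≤2k (≤-trans (<⇒≤ q<k) k≤2k) (<⇒≢ 1<q)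
                  (inB⁺ {1} z<s 2≤k) (inB⁺ (<-trans z<s 1<q) q<k) (1∉E q) (q∉E (<-trans z<s 1<q)) one)
  ... | inj₂ (inj₂ (q , (1<q , q<k) , refl)) | inj₁ refl =
        ⊥-elim (two-outside (inE q) inA 1+k≤2k (k+q≤2k q<k) (λ k+1≡k+q → <-irrefl (+-cancelˡ-≡ k 1 q (trans (+-comm k 1) k+1≡k+q)) 1<q)
                  (inE⁺ q (s≤s 0<k) ≤-refl (λ k+1≡q → <-asym q<k (subst (k <_) k+1≡q (n<1+n k)))) (inE-top q)
                  (λ k+1∈A → 1+n≰n (proj₂ (inA⁻ k+1∈A)))
                  (λ k+q∈A → <-irrefl refl (<-≤-trans (subst (_< k + q) (+-identityʳ k) (+-monoʳ-< k (<-trans z<s 1<q))) (proj₂ (inA⁻ k+q∈A))))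
                  one)
  ... | inj₂ (inj₂ (q , (1<q , q<k) , refl)) | inj₂ (inj₁ refl) =
        ⊥-elim (two-outside (inE q) inB k≤2k (k+q≤2k q<k) (λ k≡k+q → <-irrefl (trans (+-identityʳ k) k≡k+q) (+-monoʳ-< k (<-trans z<s 1<q)))
                  (inE⁺ q 2≤k (n≤1+n k) (λ k≡q → <-irrefl (sym k≡q) q<k)) (inE-top q)
                  (λ k∈B → [ (λ (_ , k<k) → <-irrefl refl k<k) , (λ k≡k+1 → <-irrefl k≡k+1 (n<1+n k)) ]′ (inB⁻ k∈B))
                  (λ k+q∈B → [ (λ (_ , k+q<k) → <-irrefl refl (<-≤-trans k+q<k (m≤m+n k q)))
                             , (λ k+q≡k+1 → <-irrefl (sym (+-cancelˡ-≡ k q 1 (trans k+q≡k+1 (+-comm 1 k)))) 1<q) ]′ (inB⁻ k+q∈B))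
                  one)
  ... | inj₂ (inj₂ (q , (1<q , q<k) , refl)) | inj₂ (inj₂ (q′ , (1<q′ , q′<k) , refl)) with q ≟ q′
  ...   | yes refl = ⊥-elim (X≢Y refl)
  ...   | no q≢q′ = ⊥-elim (two-outside (inE q) (inE q′) (k+q≤2k q<k) (≤-trans (<⇒≤ q′<k) k≤2k)
                  (λ k+q≡q′ → <-irrefl refl (<-≤-trans (subst (_< k + q) (sym k+q≡q′) (<-≤-trans q′<k (m≤m+n k q))) ≤-refl))
                  (inE-top q) (inE⁺ q 1<q′ (≤-trans (<⇒≤ q′<k) (n≤1+n k)) (≢-sym q≢q′)) (k+q∉E 1<q q≢q′) (q∉E (<-trans z<s 1<q′)) one)

  -- Every edge X of F has an apex y such that X minus y, together with the
  -- centre, lies in an edge of G (D₀ for A and B, D q for E q).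
  apex : ∀ X → T (F X) → Σ (Fin N) λ y → y ∈ X ×
         Σ (Subset N) λ Z → T (G Z) × fzero ∈ Z × (∀ {x} → x ∈ X → x ≢ y → x ∈ Z)
  apex X X∈F with F-cases X X∈F
  ... | inj₁ refl = vertex k k≤2k , vertex∈ inA k≤2k (inA⁺ 0<k ≤-refl) , D₀ , D₀∈G , select⁺ inD₀ (below⁺ {k} {0} 0<k) ,
        λ {x} x∈A x≢k → select⁺ inD₀ (below⁺ (≤∧≢⇒< (proj₂ (inA⁻ (select⁻ inA x∈A))) (≢vertex k≤2k x≢k)))
  ... | inj₂ (inj₁ refl) = vertex (suc k) 1+k≤2k , vertex∈ inB 1+k≤2k inB-top , D₀ , D₀∈G , select⁺ inD₀ (below⁺ {k} {0} 0<k) ,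
        λ {x} x∈B x≢k+1 → select⁺ inD₀ (below⁺ ([ proj₂ , (λ x≡k+1 → ⊥-elim (≢vertex 1+k≤2k x≢k+1 x≡k+1)) ]′ (inB⁻ (select⁻ inB x∈B))))
  ... | inj₂ (inj₂ (q , (1<q , q<k) , refl)) = vertex (k + q) (k+q≤2k q<k) , vertex∈ (inE q) (k+q≤2k q<k) (inE-top q) ,
        D q , D∈G 1<q q<k , D-contains-centre 1<q , λ {x} x∈E x≢k+q → select⁺ (inD q) (in-D x∈E x≢k+q)
    where
    in-D : ∀ {x} → x ∈ E q → x ≢ vertex (k + q) (k+q≤2k q<k) → T (inD q (toℕ x))
    in-D {x} x∈E x≢k+q with inE⁻ q (select⁻ (inE q) x∈E)
    ... | inj₁ (1<x , x≤k+1 , x≢q) = inD⁺ q (>⇒≢ 1<x) (s≤s x≤k+1) x≢q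
    ... | inj₂ x≡k+q = ⊥-elim (≢vertex (k+q≤2k q<k) x≢k+q x≡k+q)

  one : Fin N
  one = vertex 1 1≤2k

  one∈A : one ∈ A
  one∈A = vertex∈ inA 1≤2k (inA⁺ {1} z<s 0<k)

  one∈B : one ∈ B
  one∈B = vertex∈ inB 1≤2k (inB⁺ {1} z<s 2≤k)

  pair-apex : ∀ {w} → w ∈ A → w ∈ B → w ≢ one →
    Σ (Subset N) λ Z → T (G Z) × fzero ∈ Z × (∀ {x} → x ∈ A ⊎ x ∈ B → x ≢ one → x ≢ w → x ∈ Z)
  pair-apex {w} w∈A w∈B w≢1 = D q , D∈G 1<q q<k , D-contains-centre 1<q , in-D
    where
    q : ℕ
    q = toℕ w
    q<k : q < k
    q<k = [ proj₂ , (λ q≡k+1 → ⊥-elim (1+n≰n (subst (_≤ k) q≡k+1 (proj₂ (inA⁻ (select⁻ inA w∈A)))))) ]′ (inB⁻ (select⁻ inB w∈B))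
    1<q : 1 < q
    1<q = ≤∧≢⇒< (proj₁ (inA⁻ (select⁻ inA w∈A))) (≢-sym (≢vertex 1≤2k w≢1))
    x<k+2 : ∀ {x} → x ∈ A ⊎ x ∈ B → toℕ x < 2 + k
    x<k+2 (inj₁ x∈A) = s≤s (≤-trans (proj₂ (inA⁻ (select⁻ inA x∈A))) (n≤1+n k))
    x<k+2 {x} (inj₂ x∈B) = [ (λ (_ , x<k) → <-trans x<k (<-trans (n<1+n k) (n<1+n (suc k)))) , (λ x≡k+1 → s≤s (≤-reflexive x≡k+1)) ]′ (inB⁻ (select⁻ inB x∈B))
    in-D : ∀ {x} → x ∈ A ⊎ x ∈ B → x ≢ one → x ≢ w → x ∈ D q
    in-D {x} x∈A∪B x≢1 x≢w = select⁺ (inD q) (inD⁺ q (≢vertex 1≤2k x≢1) (x<k+2 x∈A∪B) (x≢w ∘ toℕ-injective))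

  module Cycle {p} (k<ℓ : k < suc p) (C : TightCycleCopy k p H′) (b : Fin (suc p)) where
    open Windows k H′ p k<ℓ C b public

    F-window : ∀ a → fzero ∉ W a → T (F (W a))
    F-window a 0∉Wa = H′-avoiding-centre (W a) (W-edge a) 0∉Wa

    adjacent : ∀ a → T (F (W a)) → T (F (W (suc a))) → (W a ≡ A × W (suc a) ≡ B) ⊎ (W a ≡ B × W (suc a) ≡ A)
    adjacent a Wa∈F Wa+1∈F = F-adjacent (W a) (W (suc a)) Wa∈F Wa+1∈F (W-step-distinct 0<k a) (consecutive-windows a)

    no-three-F-windows : ∀ a → T (F (W a)) → T (F (W (1 + a))) → T (F (W (2 + a))) → ⊥
    no-three-F-windows a W₀∈F W₁∈F W₂∈F = clash (adjacent a W₀∈F W₁∈F) (adjacent (suc a) W₁∈F W₂∈F)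
      where
      clash : (W a ≡ A × W (1 + a) ≡ B) ⊎ (W a ≡ B × W (1 + a) ≡ A) →
              (W (1 + a) ≡ A × W (2 + a) ≡ B) ⊎ (W (1 + a) ≡ B × W (2 + a) ≡ A) → ⊥
      clash (inj₁ (_ , W₁≡B)) (inj₁ (W₁≡A , _)) = A≢B (trans (sym W₁≡A) W₁≡B)
      clash (inj₁ (W₀≡A , _)) (inj₂ (_ , W₂≡A)) = W-two-step-distinct 2≤k a (trans W₀≡A (sym W₂≡A))
      clash (inj₂ (W₀≡B , _)) (inj₁ (_ , W₂≡B)) = W-two-step-distinct 2≤k a (trans W₀≡B (sym W₂≡B))
      clash (inj₂ (_ , W₁≡A)) (inj₂ (W₁≡B , _)) = A≢B (trans (sym W₁≡A) W₁≡B)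

    module ThroughCentre (vb≡0 : v b ≡ fzero) where

      u0≡0 : u 0 ≡ fzero
      u0≡0 = trans u-start vb≡0

      inner-F-window : ∀ {a} → 0 < a → a + k ≤ ℓ → T (F (W a))
      inner-F-window 0<a a+k≤ℓ = F-window _ (subst (_∉ W _) u0≡0 (start-outside 0<a a+k≤ℓ))

      covered : ∀ {a} → u 0 ∈ W a → ∀ Z → T (G Z) → fzero ∈ Z → (∀ {x} → x ∈ W a → x ≢ u 0 → x ∈ Z) → ⊥
      covered {a} u0∈Wa Z Z∈G 0∈Z cover = no-G-cover (W a) Z (W-edge a) (subst (_∈ W a) u0≡0 u0∈Wa) Z∈G W⊆Z
        where
        by-cases : ∀ {x} → x ∈ W a → Dec (x ≡ u 0) → x ∈ Z
        by-cases _ (yes x≡u0) = subst (_∈ Z) (sym (trans x≡u0 u0≡0)) 0∈Z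
        by-cases x∈Wa (no x≢u0) = cover x∈Wa x≢u0
        W⊆Z : W a ⊆ Z
        W⊆Z {x} x∈Wa = by-cases x∈Wa (x Data.Fin.≟ u 0)

      -- ℓ = k + 1: W 1 is an edge of F; omit its apex.
      length-k+1 : ℓ ≡ suc k → ⊥
      length-k+1 ℓ≡k+1 =
        let (y , y∈W₁ , Z , Z∈G , 0∈Z , cover-apex) = apex (W 1) (inner-F-window z<s (≤-reflexive (sym ℓ≡k+1)))
            (a , u0∈Wa , others) = omit-one ℓ≡k+1 y∈W₁
        in covered u0∈Wa Z Z∈G 0∈Z λ x∈Wa x≢u0 →
             [ (λ x≡u0 → ⊥-elim (x≢u0 x≡u0)) , (λ (x∈W₁ , x≢y) → cover-apex x∈W₁ x≢y) ]′ (others x∈Wa)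

      -- ℓ = k + 2: W 1 and W 2 are A and B; omit 1 and a second common vertex.
      length-k+2 : ℓ ≡ suc (suc k) → ⊥
      length-k+2 ℓ≡k+2 =
        let W₁₂ = adjacent 1 (inner-F-window z<s k+1≤ℓ) (inner-F-window z<s (≤-reflexive (sym ℓ≡k+2)))
            (w , (w∈W₁ , w∈W₂ , w≢1) , a , u0∈Wa , others) = omit-two 2<k (proj₁ (into-W W₁₂ one∈A one∈B)) (proj₂ (into-W W₁₂ one∈A one∈B))
            (w∈A , w∈B) = from-W W₁₂ w∈W₁ w∈W₂
            (Z , Z∈G , 0∈Z , cover) = pair-apex w∈A w∈B w≢1
        in covered u0∈Wa Z Z∈G 0∈Z λ x∈Wa x≢u0 →
             [ (λ x≡u0 → ⊥-elim (x≢u0 x≡u0)) , (λ (x∈W₁₂ , x≢1 , x≢w) → cover (from-W∪ W₁₂ x∈W₁₂) x≢1 x≢w) ]′ (others x∈Wa)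
        where
        open Length+2 ℓ≡k+2
        k+1≤ℓ : 1 + k ≤ ℓ
        k+1≤ℓ = subst (1 + k ≤_) (sym ℓ≡k+2) (n≤1+n (suc k))
        AB : Set
        AB = (W 1 ≡ A × W 2 ≡ B) ⊎ (W 1 ≡ B × W 2 ≡ A)
        into-W : AB → ∀ {x} → x ∈ A → x ∈ B → x ∈ W 1 × x ∈ W 2
        into-W (inj₁ (W₁≡A , W₂≡B)) x∈A x∈B = subst (_ ∈_) (sym W₁≡A) x∈A , subst (_ ∈_) (sym W₂≡B) x∈B
        into-W (inj₂ (W₁≡B , W₂≡A)) x∈A x∈B = subst (_ ∈_) (sym W₁≡B) x∈B , subst (_ ∈_) (sym W₂≡A) x∈A
        from-W : AB → ∀ {x} → x ∈ W 1 → x ∈ W 2 → x ∈ A × x ∈ B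
        from-W (inj₁ (W₁≡A , W₂≡B)) x∈W₁ x∈W₂ = subst (_ ∈_) W₁≡A x∈W₁ , subst (_ ∈_) W₂≡B x∈W₂
        from-W (inj₂ (W₁≡B , W₂≡A)) x∈W₁ x∈W₂ = subst (_ ∈_) W₂≡A x∈W₂ , subst (_ ∈_) W₁≡B x∈W₁
        from-W∪ : AB → ∀ {x} → x ∈ W 1 ⊎ x ∈ W 2 → x ∈ A ⊎ x ∈ B
        from-W∪ (inj₁ (W₁≡A , W₂≡B)) = Data.Sum.map (subst (_ ∈_) W₁≡A) (subst (_ ∈_) W₂≡B)
        from-W∪ (inj₂ (W₁≡B , W₂≡A)) = Data.Sum.swap ∘ Data.Sum.map (subst (_ ∈_) W₁≡B) (subst (_ ∈_) W₂≡A)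

      -- ℓ ≥ k + 3: the windows 1, 2, 3 are edges of F.
      length≥k+3 : 3 + k ≤ ℓ → ⊥
      length≥k+3 k+3≤ℓ = no-three-F-windows 1 (inner-F-window z<s (≤-trans (n≤1+n _) (≤-trans (n≤1+n _) k+3≤ℓ)))
                                              (inner-F-window z<s (≤-trans (n≤1+n _) k+3≤ℓ)) (inner-F-window z<s k+3≤ℓ)

      impossible : ⊥
      impossible = [ (λ k+1<ℓ → [ length≥k+3 , length-k+2 ∘ sym ]′ (m≤n⇒m<n∨m≡n k+1<ℓ)) , length-k+1 ∘ sym ]′ (m≤n⇒m<n∨m≡n k<ℓ)

  -- H′ is tight-cycle-free: a tight cycle either passes through the centre,
  -- or it avoids it and then all its windows are edges of F.
  H′-tight-cycle-free : TightCycleFree k H′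
  H′-tight-cycle-free p k+1≤p+1 C = by-cases (any? (λ i → proj₁ C i Data.Fin.≟ fzero))
    where
    open Cycle k+1≤p+1 C fzero using (W; window-vertex; F-window; no-three-F-windows)
    by-cases : Dec (∃ λ i → proj₁ C i ≡ fzero) → ⊥
    by-cases (yes (b , vb≡0)) = Cycle.ThroughCentre.impossible k+1≤p+1 C b vb≡0
    by-cases (no centre∉C) = no-three-F-windows 0 (F-window 0 (avoids 0)) (F-window 1 (avoids 1)) (F-window 2 (avoids 2))
      where
      avoids : ∀ a → fzero ∉ W a
      avoids a 0∈Wa = centre∉C (window-vertex {a} 0∈Wa)

lemma3p4 : ∀ (k : ℕ) → 3 ≤ k →
    ∃ λ (m : ℕ) → 1 ≤ m × (∀ (n : ℕ) → m ≤ n →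
    Σ (Hypergraph (suc n)) λ F → Σ (Hypergraph (suc n)) λ G →
    Σ (Subset (suc n)) λ VF →
    Uniform k F × Uniform k G ×
    Fin.zero ∉ VF × ∣ VF ∣ ≤ m × (∀ e → IsEdge F e → e ⊆ VF) ×
    G ⊑ fullStar k n ×
    TightCycleFree k ((fullStar k n ∖ G) ∪ F) ×
    edges ((fullStar k n ∖ G) ∪ F) ≡ edges (fullStar k n) + 1)
lemma3p4 k 3≤k = k + k , 1≤2k , λ n 2k≤n →
  let open Gadget k 3≤k n 2k≤n in
  F , G , V , F-uniform , G-uniform , centre∉V , ∣V∣ , F⊆V , G⊑star , H′-tight-cycle-free , count-H′
  where
  1≤2k : 1 ≤ k + k
  1≤2k = ≤-trans (s≤s z≤n) (≤-trans 3≤k (m≤m+n k k))
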